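{- Let $G=(V,E)$ be a finite simple graph and let $e=\{u,v\}\in E$. Then $e$ is an irrelevant edge of $G$ if and only if both $u$ and $v$ are domination-covered in $G-e$.
   Context: The domination polynomial of $G=(V,E)$ is $D(G,x)=\sum_{W\subseteq V,\ N_G[W]=V}x^{|W|}$, where $N_G[W]$ is the closed neighborhood of $W$. An edge $e$ of $G$ is irrelevant if $D(G,x)=D(G-e,x)$, where $G-e$ removes the edge $e$. A vertex $w$ of a graph $H$ is domination-covered in $H$ if every dominating set of $H-w$ contains at least one vertex adjacent to $w$ in $H$. -}

module Defs where

open import Data.Nat using (ℕ; zero; suc)
open import Data.Bool using (Bool; true; false; _∧_; not; _∨_)
open import Data.Fin using (Fin)
open import Data.Fin.Properties using (_≟_; any?)
open import Data.Fin.Subset using (Subset; _∈_; _∉_; ∣_∣; inside; outside)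
open import Data.Fin.Subset.Properties using (_∈?_)
open import Data.Vec using (Vec; []; _∷_)
open import Data.List using (List; []; _∷_; map; _++_; filter; length; upTo)
open import Data.Product using (Σ; _×_; _,_; ∃)
open import Data.Sum using (_⊎_)
open import Relation.Binary.PropositionalEquality using (_≡_)
open import Relation.Nullary using (Dec; ¬_; yes; no)
open import Relation.Nullary.Decidable using (_⊎-dec_; _×-dec_; ⌊_⌋)
open import Data.Nat.Properties using () renaming (_≟_ to _≟ℕ_)

record Graph (n : ℕ) : Set where
  field
    adj    : Fin n → Fin n → Bool
    sym    : ∀ i j → adj i j ≡ adj j i
    irrefl : ∀ i → adj i i ≡ false
open Graph public

Adj : ∀ {n} → Graph n → Fin n → Fin n → Set
Adj G i j = adj G i j ≡ true

samePair : ∀ {n} → Fin n → Fin n → Fin n → Fin n → Bool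
samePair u v i j = ⌊ ((u ≟ i) ×-dec (v ≟ j)) ⊎-dec ((u ≟ j) ×-dec (v ≟ i)) ⌋

symPair : ∀ {n} (u v : Fin n) i j → samePair u v i j ≡ samePair u v j i
symPair u v i j with u ≟ i | v ≟ j | u ≟ j | v ≟ i
... | yes _ | yes _ | yes _ | yes _ = Relation.Binary.PropositionalEquality.refl
... | yes _ | yes _ | yes _ | no _ = Relation.Binary.PropositionalEquality.refl
... | yes _ | yes _ | no _ | yes _ = Relation.Binary.PropositionalEquality.refl
... | yes _ | yes _ | no _ | no _ = Relation.Binary.PropositionalEquality.refl
... | yes _ | no _ | yes _ | yes _ = Relation.Binary.PropositionalEquality.refl
... | yes _ | no _ | yes _ | no _ = Relation.Binary.PropositionalEquality.refl
... | yes _ | no _ | no _ | yes _ = Relation.Binary.PropositionalEquality.refl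
... | yes _ | no _ | no _ | no _ = Relation.Binary.PropositionalEquality.refl
... | no _ | yes _ | yes _ | yes _ = Relation.Binary.PropositionalEquality.refl
... | no _ | yes _ | yes _ | no _ = Relation.Binary.PropositionalEquality.refl
... | no _ | yes _ | no _ | yes _ = Relation.Binary.PropositionalEquality.refl
... | no _ | yes _ | no _ | no _ = Relation.Binary.PropositionalEquality.refl
... | no _ | no _ | yes _ | yes _ = Relation.Binary.PropositionalEquality.refl
... | no _ | no _ | yes _ | no _ = Relation.Binary.PropositionalEquality.refl
... | no _ | no _ | no _ | yes _ = Relation.Binary.PropositionalEquality.refl
... | no _ | no _ | no _ | no _ = Relation.Binary.PropositionalEquality.refl

removeEdge : ∀ {n} → Graph n → Fin n → Fin n → Graph n
adj    (removeEdge G u v) i j = adj G i j ∧ not (samePair u v i j)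
sym    (removeEdge G u v) i j rewrite Graph.sym G i j | symPair u v i j = Relation.Binary.PropositionalEquality.refl
irrefl (removeEdge G u v) i rewrite Graph.irrefl G i = Relation.Binary.PropositionalEquality.refl

InClosedNbhd : ∀ {n} → Graph n → Subset n → Fin n → Set
InClosedNbhd G W v = v ∈ W ⊎ (∃ λ w → w ∈ W × Adj G w v)

inClosedNbhd? : ∀ {n} (G : Graph n) (W : Subset n) (v : Fin n) → Dec (InClosedNbhd G W v)
inClosedNbhd? G W v = (v ∈? W) ⊎-dec any? (λ w → (w ∈? W) ×-dec (Data.Bool._≟_ (adj G w v) true))

Dominating : ∀ {n} → Graph n → Subset n → Set
Dominating G W = ∀ v → InClosedNbhd G W v

dominating? : ∀ {n} (G : Graph n) (W : Subset n) → Dec (Dominating G W)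
dominating? G W = Data.Fin.Properties.all? (inClosedNbhd? G W)

allSubsets : (n : ℕ) → List (Subset n)
allSubsets zero = [] ∷ []
allSubsets (suc n) = map (inside ∷_) (allSubsets n) ++ map (outside ∷_) (allSubsets n)

domCoeff : ∀ {n} → Graph n → ℕ → ℕ
domCoeff {n} G k = length (filter (λ W → dominating? G W ×-dec (∣ W ∣ ≟ℕ k)) (allSubsets n))

-- D(G,x) as its list of coefficients [d_0, d_1, …, d_n] (degree ≤ n)
domPoly : ∀ {n} → Graph n → List ℕ
domPoly {n} G = map (domCoeff G) (upTo (suc n))

Irrelevant : ∀ {n} → Graph n → Fin n → Fin n → Set
Irrelevant G u v = domPoly G ≡ domPoly (removeEdge G u v)

-- W is a dominating set of H - w: the vertex-deleted graph H - w has vertex set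
-- V ∖ {w} and the induced adjacency, so W ⊆ V ∖ {w} and every vertex x ≠ w
-- is in W or adjacent (in H) to some vertex of W.
DominatingMinus : ∀ {n} → Graph n → Fin n → Subset n → Set
DominatingMinus H w W = w ∉ W × (∀ x → ¬ (x ≡ w) → InClosedNbhd H W x)

DominationCovered : ∀ {n} → Graph n → Fin n → Set
DominationCovered H w = ∀ W → DominatingMinus H w W → ∃ λ x → x ∈ W × Adj H x w

module Submission where

-- Write H = G - e.  H is a spanning subgraph of G, so every dominating set of H
-- dominates G, and the k-th coefficient of D(H,x) counts a subfamily of the sets
-- counted by the k-th coefficient of D(G,x).  Hence D(G,x) = D(H,x) holds exactly
-- when every dominating set of G also dominates H (the counting part of the file).
--
-- A set W
-- dominating G can only fail to dominate H at an endpoint, say u ∉ W, whose sole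
-- dominator was v.  Then W dominates H - u, so if u is domination-covered W contains
-- an H-neighbour of u.  Conversely, if some W dominating H - u has no H-neighbour of
-- u, then W ∪ {v} dominates G but not H.

open import Defs
open import Data.Nat using (ℕ; suc; s≤s)
open import Data.Nat.Properties using () renaming (_≟_ to _≟ℕ_)
open import Data.Fin using (Fin)
open import Data.Fin.Properties using (_≟_; any?)
open import Data.Fin.Subset using (Subset; _∈_; _∉_; ∣_∣; inside; outside; _∪_; ⁅_⁆)
open import Data.Fin.Subset.Properties
  using (_∈?_; ∣p∣≤n; x∈p∪q⁺; x∈p∪q⁻; x∈⁅x⁆; x∈⁅y⁆⇒x≡y)
open import Data.Bool using (true; false; _∧_; not) renaming (_≟_ to _≟ᵇ_)
open import Data.Bool.Properties using (∧-zeroʳ)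
open import Data.Vec using ([]; _∷_)
open import Data.List using (List; _∷_; map; filter; length; upTo)
open import Data.List.Properties using (filter-≐; ∷-injective; map-cong)
open import Data.List.Membership.Propositional using () renaming (_∈_ to _∈ₗ_)
open import Data.List.Membership.Propositional.Properties
  using (∈-upTo⁺; ∈-map⁺; ∈-++⁺ˡ; ∈-++⁺ʳ; ∈-filter⁺; ∈-filter⁻)
open import Data.List.Relation.Unary.Any using (here; there)
open import Data.List.Relation.Binary.Pointwise using (Pointwise-≡⇒≡)
open import Data.List.Relation.Binary.Sublist.Propositional using (_⊆_; ⊆-refl)
open import Data.List.Relation.Binary.Sublist.Propositional.Properties using (filter⁺)
open import Data.List.Relation.Binary.Sublist.Heterogeneous.Properties using (toPointwise)
open import Data.Product using (_×_; _,_; proj₁; proj₂; ∃)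
open import Data.Sum using (_⊎_; inj₁; inj₂)
open import Data.Empty using (⊥-elim)
open import Function.Bundles using (_⇔_; mk⇔)
open import Level using (0ℓ)
open import Relation.Binary.PropositionalEquality
  using (_≡_; _≢_; refl; trans; cong; subst)
  renaming (sym to ≡-sym)
open import Relation.Nullary using (Dec; yes; no; ¬_)
open import Relation.Nullary.Decidable using (_×-dec_; _⊎-dec_; dec-true; dec-false; isYes≗does)
open import Relation.Unary using (Pred; Decidable)

filter-length-≡⇒⊆ : ∀ {A : Set} {P Q : Pred A 0ℓ} (P? : Decidable P) (Q? : Decidable Q) →
  (∀ {x} → Q x → P x) → ∀ xs → length (filter Q? xs) ≡ length (filter P? xs) →
  ∀ {x} → x ∈ₗ xs → P x → Q x
filter-length-≡⇒⊆ P? Q? Q⊆P xs same-length {x} x∈xs px =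
  proj₂ (∈-filter⁻ Q? {xs = xs} (subst (x ∈ₗ_) (≡-sym same-filter) (∈-filter⁺ P? x∈xs px)))
  where
    Qs⊆Ps : filter Q? xs ⊆ filter P? xs
    Qs⊆Ps = filter⁺ Q? P? {as = xs} {bs = xs} (λ { refl → Q⊆P }) ⊆-refl

    -- a sublist of the same length is the whole list
    same-filter : filter Q? xs ≡ filter P? xs
    same-filter = Pointwise-≡⇒≡ (toPointwise same-length Qs⊆Ps)

map-≡⇒pointwise : ∀ {A B : Set} (f g : A → B) (xs : List A) →
  map f xs ≡ map g xs → ∀ {x} → x ∈ₗ xs → f x ≡ g x
map-≡⇒pointwise f g (x ∷ xs) eq (here refl) = proj₁ (∷-injective eq)
map-≡⇒pointwise f g (x ∷ xs) eq (there x∈xs) =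
  map-≡⇒pointwise f g xs (proj₂ (∷-injective eq)) x∈xs

allSubsets-complete : ∀ {n} (W : Subset n) → W ∈ₗ allSubsets n
allSubsets-complete []            = here refl
allSubsets-complete (inside ∷ W)  = ∈-++⁺ˡ (∈-map⁺ (inside ∷_) (allSubsets-complete W))
allSubsets-complete {suc n} (outside ∷ W) =
  ∈-++⁺ʳ (map (inside ∷_) (allSubsets n)) (∈-map⁺ (outside ∷_) (allSubsets-complete W))

_⊑_ : ∀ {n} → Graph n → Graph n → Set
H ⊑ G = ∀ {i j} → Adj H i j → Adj G i j

PreservesDomination : ∀ {n} → Graph n → Graph n → Set
PreservesDomination G H = ∀ W → Dominating G W → Dominating H W

dominating-mono : ∀ {n} {G H : Graph n} → H ⊑ G → PreservesDomination H G
dominating-mono H⊑G W dom x with dom x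
... | inj₁ x∈W             = inj₁ x∈W
... | inj₂ (w , w∈W , adj) = inj₂ (w , w∈W , H⊑G adj)

module SpanningSubgraph {n} (G H : Graph n) (H⊑G : H ⊑ G) where

  counted? : (K : Graph n) (k : ℕ) → Decidable (λ W → Dominating K W × ∣ W ∣ ≡ k)
  counted? K k W = dominating? K W ×-dec (∣ W ∣ ≟ℕ k)

  counted-H⇒counted-G : ∀ {k W} → Dominating H W × ∣ W ∣ ≡ k → Dominating G W × ∣ W ∣ ≡ k
  counted-H⇒counted-G (dom , size) = dominating-mono {G = G} {H = H} H⊑G _ dom , size

  preserves⇒domPoly-≡ : PreservesDomination G H → domPoly G ≡ domPoly H
  preserves⇒domPoly-≡ G→H = map-cong coeff-≡ (upTo (suc n))
    where
      coeff-≡ : ∀ k → domCoeff G k ≡ domCoeff H k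
      coeff-≡ k = cong length (filter-≐ (counted? G k) (counted? H k)
        ((λ (dom , size) → G→H _ dom , size) , counted-H⇒counted-G) (allSubsets n))

  -- A dominating set W of G missed by H would make the coefficient of x^∣W∣ in
  -- D(H,x) strictly smaller.
  domPoly-≡⇒preserves : domPoly G ≡ domPoly H → PreservesDomination G H
  domPoly-≡⇒preserves poly-≡ W dom = proj₁
    (filter-length-≡⇒⊆ (counted? G k) (counted? H k) counted-H⇒counted-G
                       (allSubsets n) (≡-sym coeff-≡) (allSubsets-complete W) (dom , refl))
    where
      k : ℕ
      k = ∣ W ∣

      coeff-≡ : domCoeff G k ≡ domCoeff H k
      coeff-≡ = map-≡⇒pointwise (domCoeff G) (domCoeff H) (upTo (suc n)) poly-≡
                                (∈-upTo⁺ (s≤s (∣p∣≤n W)))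

-- The properties of H = G - {u,v} used in the argument.  They are symmetric in
-- u and v (see swap), which halves the work.
record IsEdgeDeletion {n} (G H : Graph n) (u v : Fin n) : Set where
  field
    edge    : Adj G u v
    sub     : H ⊑ G
    keep    : ∀ {i j} → Adj G i j → ¬ (i ≡ u × j ≡ v) → ¬ (i ≡ v × j ≡ u) → Adj H i j
    deleted : ¬ Adj H u v

  endpoints-distinct : u ≢ v
  endpoints-distinct refl with () ← trans (≡-sym edge) (irrefl G u)

  swap : IsEdgeDeletion G H v u
  swap = record
    { edge    = trans (Graph.sym G v u) edge
    ; sub     = sub
    ; keep    = λ edgeG ¬vu ¬uv → keep edgeG ¬uv ¬vu
    ; deleted = λ edgeH → deleted (trans (Graph.sym H u v) edgeH)
    }

module _ {n} (G : Graph n) (u v : Fin n) where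

  samePair? : ∀ i j → Dec ((u ≡ i × v ≡ j) ⊎ (u ≡ j × v ≡ i))
  samePair? i j = ((u ≟ i) ×-dec (v ≟ j)) ⊎-dec ((u ≟ j) ×-dec (v ≟ i))

  samePair-self : samePair u v u v ≡ true
  samePair-self = trans (isYes≗does (samePair? u v)) (dec-true (samePair? u v) (inj₁ (refl , refl)))

  samePair-other : ∀ {i j} → ¬ (i ≡ u × j ≡ v) → ¬ (i ≡ v × j ≡ u) → samePair u v i j ≡ false
  samePair-other {i} {j} ¬uv ¬vu = trans (isYes≗does (samePair? i j)) (dec-false (samePair? i j) λ
    { (inj₁ (refl , refl)) → ¬uv (refl , refl)
    ; (inj₂ (refl , refl)) → ¬vu (refl , refl) })

  removeEdge-isEdgeDeletion : Adj G u v → IsEdgeDeletion G (removeEdge G u v) u v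
  removeEdge-isEdgeDeletion uv = record
    { edge    = uv
    ; sub     = λ {i} {j} → kept-edge-of-G (adj G i j)
    ; keep    = λ edgeG ¬uv ¬vu → survives edgeG (samePair-other ¬uv ¬vu)
    ; deleted = λ edgeH → false≢true (trans (≡-sym (∧-zeroʳ (adj G u v)))
                            (subst (λ b → adj G u v ∧ not b ≡ true) samePair-self edgeH))
    }
    where
      kept-edge-of-G : ∀ a {b} → a ∧ b ≡ true → a ≡ true
      kept-edge-of-G true _ = refl

      survives : ∀ {a b} → a ≡ true → b ≡ false → a ∧ not b ≡ true
      survives refl refl = refl

      false≢true : false ≢ true
      false≢true ()

module EdgeDeletion {n} {G H : Graph n} {u v : Fin n} (E : IsEdgeDeletion G H u v) where
  open IsEdgeDeletion E

  dominated-off-edge : ∀ W → Dominating G W → ∀ x → x ∉ W →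
    ¬ (x ≡ u × v ∈ W) → ¬ (x ≡ v × u ∈ W) → InClosedNbhd H W x
  dominated-off-edge W dom x x∉W ¬uv ¬vu with dom x
  ... | inj₁ x∈W             = ⊥-elim (x∉W x∈W)
  ... | inj₂ (w , w∈W , w~x) = inj₂ (w , w∈W , keep w~x
          (λ { (refl , refl) → ¬vu (refl , w∈W) })
          (λ { (refl , refl) → ¬uv (refl , w∈W) }))

  dominating-minus : ∀ W → Dominating G W → u ∉ W → DominatingMinus H u W
  dominating-minus W dom u∉W = u∉W , dominated
    where
      dominated : ∀ x → x ≢ u → InClosedNbhd H W x
      dominated x x≢u with x ∈? W
      ... | yes x∈W = inj₁ x∈W
      ... | no  x∉W = dominated-off-edge W dom x x∉W
                        (λ (x≡u , _) → x≢u x≡u) (λ (_ , u∈W) → u∉W u∈W)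

  covered⇒endpoint-dominated : DominationCovered H u →
    ∀ W → Dominating G W → InClosedNbhd H W u
  covered⇒endpoint-dominated covered W dom with u ∈? W
  ... | yes u∈W = inj₁ u∈W
  ... | no  u∉W = inj₂ (covered W (dominating-minus W dom u∉W))

  -- Adding v to a dominating set of H - u yields a dominating set of G, since v
  -- dominates u through the deleted edge.
  add-endpoint-dominates : ∀ W → DominatingMinus H u W → Dominating G (W ∪ ⁅ v ⁆)
  add-endpoint-dominates W (_ , dominated) x with x ≟ u
  ... | yes refl = inj₂ (v , x∈p∪q⁺ (inj₂ (x∈⁅x⁆ v)) , trans (Graph.sym G v u) edge)
  ... | no  x≢u with dominated x x≢u
  ...   | inj₁ x∈W             = inj₁ (x∈p∪q⁺ (inj₁ x∈W))
  ...   | inj₂ (w , w∈W , w~x) = inj₂ (w , x∈p∪q⁺ (inj₁ w∈W) , sub w~x)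

  add-endpoint-misses : ∀ W → u ∉ W → ¬ (∃ λ x → x ∈ W × Adj H x u) →
    ¬ InClosedNbhd H (W ∪ ⁅ v ⁆) u
  add-endpoint-misses W u∉W no-neighbour (inj₁ u∈W∪v) with x∈p∪q⁻ W ⁅ v ⁆ u∈W∪v
  ... | inj₁ u∈W = u∉W u∈W
  ... | inj₂ u∈v = endpoints-distinct (x∈⁅y⁆⇒x≡y v u∈v)
  add-endpoint-misses W u∉W no-neighbour (inj₂ (w , w∈W∪v , w~u)) with x∈p∪q⁻ W ⁅ v ⁆ w∈W∪v
  ... | inj₁ w∈W = no-neighbour (w , w∈W , w~u)
  ... | inj₂ w∈v = deleted (trans (Graph.sym H u v) (subst (λ y → Adj H y u) (x∈⁅y⁆⇒x≡y v w∈v) w~u))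

  preserves⇒covered : PreservesDomination G H → DominationCovered H u
  preserves⇒covered preserves W W-dom-H-u@(u∉W , _)
    with any? (λ x → (x ∈? W) ×-dec (adj H x u ≟ᵇ true))
  ... | yes neighbour    = neighbour
  ... | no  no-neighbour = ⊥-elim (add-endpoint-misses W u∉W no-neighbour
          (preserves (W ∪ ⁅ v ⁆) (add-endpoint-dominates W W-dom-H-u) u))

covered⇒preserves : ∀ {n} {G H : Graph n} {u v : Fin n} → IsEdgeDeletion G H u v →
  DominationCovered H u → DominationCovered H v → PreservesDomination G H
covered⇒preserves {u = u} {v} E covered-u covered-v W dom x with x ∈? W
... | yes x∈W = inj₁ x∈W
... | no  x∉W with (x ≟ u) ×-dec (v ∈? W) | (x ≟ v) ×-dec (u ∈? W)
...   | yes (refl , _) | _              = EdgeDeletion.covered⇒endpoint-dominated E covered-u W dom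
...   | no  _          | yes (refl , _) =
  EdgeDeletion.covered⇒endpoint-dominated (IsEdgeDeletion.swap E) covered-v W dom
...   | no  ¬uv        | no  ¬vu        = EdgeDeletion.dominated-off-edge E W dom x x∉W ¬uv ¬vu

mainTheorem18 : ∀ {n} (G : Graph n) (u v : Fin n) → Adj G u v →
    Irrelevant G u v ⇔ (DominationCovered (removeEdge G u v) u × DominationCovered (removeEdge G u v) v)
mainTheorem18 G u v uv = mk⇔
  (λ irrelevant → let preserves = domPoly-≡⇒preserves irrelevant in
     EdgeDeletion.preserves⇒covered E preserves ,
     EdgeDeletion.preserves⇒covered (IsEdgeDeletion.swap E) preserves)
  (λ (covered-u , covered-v) → preserves⇒domPoly-≡ (covered⇒preserves E covered-u covered-v))
  where
    E : IsEdgeDeletion G (removeEdge G u v) u v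
    E = removeEdge-isEdgeDeletion G u v uv
    open SpanningSubgraph G (removeEdge G u v) (IsEdgeDeletion.sub E)
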